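{- Let $N=(ST,suc,\{nei_a\}_{a\in AG},L)$ be a single-coalition-first neighborhood model with neighborhood functions $\{nei_C\}_{C\subseteq AG}$. The following two conditions are equivalent: (1) for all $a\in AG$ and $s\in ST$, $nei_{\{a\}}(s)$ is a partition of $suc(s)$; (2) for all $C\subseteq AG$ and $s\in ST$, $nei_C(s)$ is a partition of $suc(s)$.
   Context: $AG$ is a finite nonempty set of agents, $AP$ a countable set of atomic propositions. A single-coalition-first neighborhood model is $N=(ST,suc,\{nei_a\}_{a\in AG},L)$ with $ST$ nonempty, $suc:ST\to\mathcal P(ST)$, $L:ST\to\mathcal P(AP)$, and for all $a,s$, $nei_a(s)\subseteq\mathcal P(ST)$ a cover of $suc(s)$ (its union is $suc(s)$ and $\emptyset\notin nei_a(s)$). For families of nonempty sets, $\Delta_1\odot\Delta_2=\{Y_1\cap Y_2\mid Y_1\in\Delta_1,Y_2\in\Delta_2,Y_1\cap Y_2\neq\emptyset\}$, extended to finitely many families ($\bigodot\{\Delta\}=\Delta$). The neighborhood functions are $nei_C(s)=\emptyset$ if $suc(s)=\emptyset$; $\{suc(s)\}$ if $suc(s)\neq\emptyset$ and $C=\emptyset$; $\bigodot\{nei_a(s)\mid a\in C\}$ otherwise (so $nei_{\{a\}}=nei_a$ when $suc(s)\ne\emptyset$). A partition of a set $Z$ is a family of nonempty subsets of $Z$ whose union is $Z$ and whose distinct members are disjoint. -}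

module Defs where

open import Level using (Level) renaming (suc to lsuc; zero to lzero)
open import Data.Nat using (ℕ; suc)
open import Data.Fin using (Fin)
open import Data.Fin.Subset using (Subset; _∈_; Nonempty) renaming (⊥ to ∅ₛ)
open import Data.Fin.Subset.Properties using (_∈?_)
open import Data.List using (List; []; _∷_; filter; allFin) renaming (map to mapL)
open import Data.Product using (Σ; ∃; _×_; _,_)
open import Data.Sum using (_⊎_)
open import Data.Empty using (⊥)
open import Relation.Nullary using (¬_)
open import Relation.Binary.PropositionalEquality using (_≡_)

SubsetOf : Set → Set₁
SubsetOf X = X → Set

Family : Set → Set₂
Family X = SubsetOf X → Set₁

module _ {X : Set} where

  _≐_ : SubsetOf X → SubsetOf X → Set
  A ≐ B = (∀ x → A x → B x) × (∀ x → B x → A x)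

  _∩_ : SubsetOf X → SubsetOf X → SubsetOf X
  (A ∩ B) x = A x × B x

  NonemptySet : SubsetOf X → Set
  NonemptySet A = ∃ λ x → A x

  -- "A ≠ ∅", read literally as ¬ (A = ∅)
  NotEmptySet : SubsetOf X → Set
  NotEmptySet A = ¬ (∀ x → ¬ A x)

  _⊙_ : Family X → Family X → Family X
  (Δ₁ ⊙ Δ₂) Y = Σ (SubsetOf X) λ Y₁ → Σ (SubsetOf X) λ Y₂ →
                  Δ₁ Y₁ × Δ₂ Y₂ × NotEmptySet (Y₁ ∩ Y₂) × (Y ≐ (Y₁ ∩ Y₂))

  -- ⨀ of a finite (nonempty) list of families; ⨀ [Δ] = Δ.
  -- The empty case is never used (only applied for nonempty coalitions).
  ⨀ : List (Family X) → Family X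
  ⨀ [] Y = Lift⊥
    where
      Lift⊥ : Set₁
      Lift⊥ = Level.Lift (lsuc lzero) ⊥
  ⨀ (Δ ∷ []) = Δ
  ⨀ (Δ ∷ Δs@(_ ∷ _)) = Δ ⊙ ⨀ Δs

  Union : Family X → X → Set₁
  Union Δ x = ∃ λ (Y : SubsetOf X) → Δ Y × Y x

  IsCover : Family X → SubsetOf X → Set₁
  IsCover Δ Z = ((∀ x → Union Δ x → Z x) × (∀ x → Z x → Union Δ x)) × (∀ Y → Δ Y → NotEmptySet Y)

  IsPartition : Family X → SubsetOf X → Set₁
  IsPartition Δ Z =
      (∀ Y → Δ Y → NotEmptySet Y)
    × (∀ Y → Δ Y → ∀ x → Y x → Z x)
    × (∀ x → Z x → ∃ λ (Y : SubsetOf X) → Δ Y × Y x)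
    × (∀ Y₁ Y₂ → Δ Y₁ → Δ Y₂ → ¬ (Y₁ ≐ Y₂) → ∀ x → Y₁ x → Y₂ x → ⊥)

-- agents: AG = Fin (suc n), finite and nonempty
members : {n : ℕ} → Subset n → List (Fin n)
members {n} C = filter (λ a → a ∈? C) (allFin n)

record SCFModel (n : ℕ) : Set₂ where
  field
    ST   : Set
    inhabited : ST
    succ : ST → SubsetOf ST
    nei  : Fin (suc n) → ST → Family ST
    L    : ST → SubsetOf ℕ        -- labelling into atomic propositions AP = ℕ
    nei-cover : ∀ a s → IsCover (nei a s) (succ s)

  neiC : Subset (suc n) → ST → Family ST
  neiC C s Y =
      (NotEmptySet (succ s) × Level.Lift (lsuc lzero) (C ≡ ∅ₛ) × Level.Lift (lsuc lzero) (Y ≐ succ s))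
    ⊎ (NotEmptySet (succ s) × Level.Lift (lsuc lzero) (Nonempty C) × ⨀ (mapL (λ a → nei a s) (members C)) Y)

{-# OPTIONS --safe #-}
-- Since members ⁅ a ⁆ = [ a ], nei_{a} is nei_a itself, so (1) says that every nei_a
-- is a partition of suc(s).  A meet Δ₁ ⊙ Δ₂ of two partitions of the same set is again
-- a partition (their common refinement), hence so is every nei_C with C ≠ ∅, while
-- nei_∅(s) = {suc(s)} is a partition as soon as suc(s) ≠ ∅.
module Submission where

open import Defs
open import Level using (Lift; lift) renaming (suc to lsuc; zero to lzero)
open import Data.Nat using (ℕ; suc)
open import Data.Bool using (true; false)
open import Data.Fin using (Fin) renaming (zero to fzero; suc to fsuc)
open import Data.Fin.Subset using (Subset; ⁅_⁆; Nonempty; inside; outside) renaming (⊥ to ∅ₛ; _∈_ to _∈ₛ_)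
open import Data.Fin.Subset.Properties using (_∈?_; nonempty?; Empty-unique; ∉⊥; x∈⁅x⁆)
open import Data.Vec using (_∷_)
open import Data.List using (List; []; _∷_; filter; allFin) renaming (map to mapL)
open import Data.List.Properties using (map-tabulate; filter-none)
open import Data.List.Relation.Unary.All using (All; []; _∷_; universal)
open import Data.List.Relation.Unary.All.Properties using (map⁺)
open import Data.List.Relation.Unary.Any using (here)
open import Data.List.Membership.Propositional using () renaming (_∈_ to _∈ₗ_)
open import Data.List.Membership.Propositional.Properties using (∈-map⁺; ∈-filter⁺; ∈-allFin)
open import Data.Product using (_×_; _,_; proj₁; proj₂)
open import Data.Sum using (inj₁; inj₂)
open import Data.Empty using (⊥; ⊥-elim)
open import Relation.Nullary using (¬_; yes; no; does)
open import Relation.Binary.PropositionalEquality using (_≡_; refl; cong; sym; trans; subst)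

module _ {X : Set} where

  ≐-refl : {A : SubsetOf X} → A ≐ A
  ≐-refl = (λ _ a → a) , (λ _ a → a)

  ≐-sym : {A B : SubsetOf X} → A ≐ B → B ≐ A
  ≐-sym (A⊆B , B⊆A) = B⊆A , A⊆B

  ≐-trans : {A B C : SubsetOf X} → A ≐ B → B ≐ C → A ≐ C
  ≐-trans (A⊆B , B⊆A) (B⊆C , C⊆B) = (λ x a → B⊆C x (A⊆B x a)) , (λ x c → B⊆A x (C⊆B x c))

  ∩-cong : {A A′ B B′ : SubsetOf X} → A ≐ A′ → B ≐ B′ → (A ∩ B) ≐ (A′ ∩ B′)
  ∩-cong (A⊆A′ , A′⊆A) (B⊆B′ , B′⊆B) =
    (λ x (a , b) → A⊆A′ x a , B⊆B′ x b) , (λ x (a′ , b′) → A′⊆A x a′ , B′⊆B x b′)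

  covering-subfamily⇒isPartition : {Δ Δ′ : Family X} {Z : SubsetOf X} →
    (∀ Y → Δ Y → Δ′ Y) → (∀ x → Z x → Union Δ x) → IsPartition Δ′ Z → IsPartition Δ Z
  covering-subfamily⇒isPartition Δ⊆Δ′ covers (nonempty , ⊆Z , _ , disjoint) =
      (λ Y d → nonempty Y (Δ⊆Δ′ Y d))
    , (λ Y d → ⊆Z Y (Δ⊆Δ′ Y d))
    , covers
    , (λ Y₁ Y₂ d₁ d₂ → disjoint Y₁ Y₂ (Δ⊆Δ′ Y₁ d₁) (Δ⊆Δ′ Y₂ d₂))

  whole-isPartition : {Z : SubsetOf X} →
    IsPartition (λ Y → NotEmptySet Z × Lift (lsuc lzero) (Y ≐ Z)) Z
  whole-isPartition =
      (λ Y (Z≢∅ , lift (_ , Z⊆Y)) Y≡∅ → Z≢∅ (λ x z → Y≡∅ x (Z⊆Y x z)))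
    , (λ Y (_ , lift (Y⊆Z , _)) → Y⊆Z)
    , (λ x z → _ , ((λ Z≡∅ → Z≡∅ x z) , lift ≐-refl) , z)
    , (λ Y₁ Y₂ (_ , lift Y₁≐Z) (_ , lift Y₂≐Z) Y₁≉Y₂ _ _ _ → Y₁≉Y₂ (≐-trans Y₁≐Z (≐-sym Y₂≐Z)))

  ⊙-isPartition : {Δ₁ Δ₂ : Family X} {Z : SubsetOf X} →
    IsPartition Δ₁ Z → IsPartition Δ₂ Z → IsPartition (Δ₁ ⊙ Δ₂) Z
  ⊙-isPartition {Δ₁} {Δ₂} {Z} (_ , ⊆Z₁ , covers₁ , disjoint₁) (_ , _ , covers₂ , disjoint₂) =
    nonempty , ⊆Z , covers , disjoint
    where
    nonempty : ∀ Y → (Δ₁ ⊙ Δ₂) Y → NotEmptySet Y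
    nonempty Y (_ , _ , _ , _ , Y₁∩Y₂≢∅ , (_ , Y₁∩Y₂⊆Y)) Y≡∅ =
      Y₁∩Y₂≢∅ (λ x y → Y≡∅ x (Y₁∩Y₂⊆Y x y))

    ⊆Z : ∀ Y → (Δ₁ ⊙ Δ₂) Y → ∀ x → Y x → Z x
    ⊆Z Y (Y₁ , _ , d₁ , _ , _ , (Y⊆Y₁∩Y₂ , _)) x y = ⊆Z₁ Y₁ d₁ x (proj₁ (Y⊆Y₁∩Y₂ x y))

    covers : ∀ x → Z x → Union (Δ₁ ⊙ Δ₂) x
    covers x z with covers₁ x z | covers₂ x z
    ... | Y₁ , d₁ , y₁ | Y₂ , d₂ , y₂ =
      (Y₁ ∩ Y₂) , (Y₁ , Y₂ , d₁ , d₂ , (λ Y₁∩Y₂≡∅ → Y₁∩Y₂≡∅ x (y₁ , y₂)) , ≐-refl) , (y₁ , y₂)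

    -- Overlapping members are only known to be ¬ ¬ equal, hence the nested refutations.
    disjoint : ∀ Y Y′ → (Δ₁ ⊙ Δ₂) Y → (Δ₁ ⊙ Δ₂) Y′ → ¬ (Y ≐ Y′) → ∀ x → Y x → Y′ x → ⊥
    disjoint Y Y′ (Y₁ , Y₂ , d₁ , d₂ , _ , Y≐) (Y₁′ , Y₂′ , d₁′ , d₂′ , _ , Y′≐) Y≉Y′ x y y′ =
      disjoint₁ Y₁ Y₁′ d₁ d₁′ Y₁≉Y₁′ x (proj₁ x∈Y₁∩Y₂) (proj₁ x∈Y₁′∩Y₂′)
      where
      x∈Y₁∩Y₂ = proj₁ Y≐ x y
      x∈Y₁′∩Y₂′ = proj₁ Y′≐ x y′
      Y₁≉Y₁′ : ¬ (Y₁ ≐ Y₁′)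
      Y₁≉Y₁′ Y₁≐Y₁′ = disjoint₂ Y₂ Y₂′ d₂ d₂′ Y₂≉Y₂′ x (proj₂ x∈Y₁∩Y₂) (proj₂ x∈Y₁′∩Y₂′)
        where
        Y₂≉Y₂′ : ¬ (Y₂ ≐ Y₂′)
        Y₂≉Y₂′ Y₂≐Y₂′ = Y≉Y′ (≐-trans Y≐ (≐-trans (∩-cong Y₁≐Y₁′ Y₂≐Y₂′) (≐-sym Y′≐)))

  ⨀-isPartition : {Δ : Family X} {Δs : List (Family X)} {Z : SubsetOf X} →
    Δ ∈ₗ Δs → All (λ Δ′ → IsPartition Δ′ Z) Δs → IsPartition (⨀ Δs) Z
  ⨀-isPartition {Δs = _ ∷ []}    _ (p ∷ [])  = p
  ⨀-isPartition {Δs = _ ∷ _ ∷ _} _ (p ∷ ps) = ⊙-isPartition p (⨀-isPartition (here refl) ps)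

module _ {n : ℕ} where

  allFin-suc : allFin (suc n) ≡ fzero ∷ mapL fsuc (allFin n)
  allFin-suc = cong (fzero ∷_) (sym (map-tabulate (λ i → i) fsuc))

  filter-∈?-∷-map-fsuc : ∀ b (C : Subset n) xs →
    filter (_∈? (b ∷ C)) (mapL fsuc xs) ≡ mapL fsuc (filter (_∈? C) xs)
  filter-∈?-∷-map-fsuc b C []       = refl
  filter-∈?-∷-map-fsuc b C (x ∷ xs) with does (x ∈? C)
  ... | true  = cong (fsuc x ∷_) (filter-∈?-∷-map-fsuc b C xs)
  ... | false = filter-∈?-∷-map-fsuc b C xs

  members-outside∷ : (C : Subset n) → members (outside ∷ C) ≡ mapL fsuc (members C)
  members-outside∷ C =
    trans (cong (filter (_∈? (outside ∷ C))) allFin-suc) (filter-∈?-∷-map-fsuc outside C (allFin n))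

  members-inside∷ : (C : Subset n) → members (inside ∷ C) ≡ fzero ∷ mapL fsuc (members C)
  members-inside∷ C = trans (cong (filter (_∈? (inside ∷ C))) allFin-suc)
                            (cong (fzero ∷_) (filter-∈?-∷-map-fsuc inside C (allFin n)))

  members-∅ : members {n} ∅ₛ ≡ []
  members-∅ = filter-none (_∈? ∅ₛ) (universal (λ _ → ∉⊥) (allFin n))

  ∈-members : {a : Fin n} {C : Subset n} → a ∈ₛ C → a ∈ₗ members C
  ∈-members {a} {C} a∈C = ∈-filter⁺ (_∈? C) (∈-allFin a) a∈C

members-⁅⁆ : {n : ℕ} (a : Fin n) → members ⁅ a ⁆ ≡ a ∷ []
members-⁅⁆ {suc n} fzero    = trans (members-inside∷ ∅ₛ) (cong (λ as → fzero ∷ mapL fsuc as) members-∅)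
members-⁅⁆ {suc n} (fsuc a) = trans (members-outside∷ ⁅ a ⁆) (cong (mapL fsuc) (members-⁅⁆ a))

module _ {n : ℕ} (N : SCFModel n) where
  open SCFModel N

  neis : ST → List (Fin (suc n)) → List (Family ST)
  neis s = mapL (λ a → nei a s)

  nei⊆succ : ∀ {a s Y} → nei a s Y → ∀ x → Y x → succ s x
  nei⊆succ {a} {s} {Y} d x y = proj₁ (proj₁ (nei-cover a s)) x (Y , d , y)

  nei⇒succ≢∅ : ∀ {a s Y} → nei a s Y → NotEmptySet (succ s)
  nei⇒succ≢∅ {a} {s} {Y} d succ≡∅ = proj₂ (nei-cover a s) Y d (λ x y → succ≡∅ x (nei⊆succ d x y))

  nei⊆neiC-⁅⁆ : ∀ a s Y → nei a s Y → neiC ⁅ a ⁆ s Y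
  nei⊆neiC-⁅⁆ a s Y d =
    inj₂ (nei⇒succ≢∅ d , lift (a , x∈⁅x⁆ a) , subst (λ as → ⨀ (neis s as) Y) (sym (members-⁅⁆ a)) d)

  neiC⊆whole : ∀ {C s} → ¬ Nonempty C →
    ∀ Y → neiC C s Y → NotEmptySet (succ s) × Lift (lsuc lzero) (Y ≐ succ s)
  neiC⊆whole C-empty Y (inj₁ (succ≢∅ , _ , Y≐succ)) = succ≢∅ , Y≐succ
  neiC⊆whole C-empty Y (inj₂ (_ , lift C≢∅ , _))    = ⊥-elim (C-empty C≢∅)

  neiC⊆⨀ : ∀ {C s} → Nonempty C → ∀ Y → neiC C s Y → ⨀ (neis s (members C)) Y
  neiC⊆⨀ C≢∅ Y (inj₁ (_ , lift C≡∅ , _)) = ⊥-elim (∉⊥ (subst (_ ∈ₛ_) C≡∅ (proj₂ C≢∅)))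
  neiC⊆⨀ C≢∅ Y (inj₂ (_ , _ , d))        = d

  nei-isPartition : (∀ a s → IsPartition (neiC ⁅ a ⁆ s) (succ s)) →
    ∀ a s → IsPartition (nei a s) (succ s)
  nei-isPartition neiC⁅⁆-partitions a s = covering-subfamily⇒isPartition
    (nei⊆neiC-⁅⁆ a s) (proj₂ (proj₁ (nei-cover a s))) (neiC⁅⁆-partitions a s)

  neiC-isPartition : (∀ a s → IsPartition (nei a s) (succ s)) →
    ∀ C s → IsPartition (neiC C s) (succ s)
  neiC-isPartition nei-partitions C s with nonempty? C
  ... | yes C≢∅@(a , a∈C) =
    covering-subfamily⇒isPartition (neiC⊆⨀ C≢∅) covers ⨀-neis-isPartition
    where
    ⨀-neis-isPartition : IsPartition (⨀ (neis s (members C))) (succ s)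
    ⨀-neis-isPartition = ⨀-isPartition (∈-map⁺ (λ b → nei b s) (∈-members a∈C))
                                        (map⁺ (universal (λ b → nei-partitions b s) (members C)))
    covers : ∀ x → succ s x → Union (neiC C s) x
    covers x z with proj₁ (proj₂ (proj₂ ⨀-neis-isPartition)) x z
    ... | Y , d , y = Y , inj₂ ((λ succ≡∅ → succ≡∅ x z) , lift C≢∅ , d) , y
  ... | no C-empty =
    covering-subfamily⇒isPartition (neiC⊆whole C-empty) covers whole-isPartition
    where
    covers : ∀ x → succ s x → Union (neiC C s) x
    covers x z = succ s , inj₁ ((λ succ≡∅ → succ≡∅ x z) , lift (Empty-unique C-empty) , lift ≐-refl) , z

theorem5p6 : (n : ℕ) (N : SCFModel n) →
    let open SCFModel N in
    ((∀ (a : Fin (suc n)) (s : ST) → IsPartition (neiC ⁅ a ⁆ s) (succ s)) →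
       (∀ (C : Subset (suc n)) (s : ST) → IsPartition (neiC C s) (succ s)))
    × ((∀ (C : Subset (suc n)) (s : ST) → IsPartition (neiC C s) (succ s)) →
       (∀ (a : Fin (suc n)) (s : ST) → IsPartition (neiC ⁅ a ⁆ s) (succ s)))
theorem5p6 n N =
    (λ neiC⁅⁆-partitions → neiC-isPartition N (nei-isPartition N neiC⁅⁆-partitions))
  , (λ neiC-partitions a → neiC-partitions ⁅ a ⁆)
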